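{- For every prime power $q\ge 2$, every integer $t\ge 2$, and all integers $n$ and $d$ with $1\le d\le n-1$, \[ \chi_q(t;n) \le \chi_q(t;n-d) + \chi_q(t;d). \]
   Context: For a prime power $q$ and integer $m\ge1$, $\mathrm{PG}(m-1,q)$ is the projective space whose points are the $1$-dimensional subspaces of $\mathbb{F}_q^m$; a $(t-1)$-dimensional projective subspace is the set of points contained in a $t$-dimensional linear subspace of $\mathbb{F}_q^m$. $\chi_q(t;m)$ denotes the minimum number of colors needed to color the points of $\mathrm{PG}(m-1,q)$ so that no $(t-1)$-dimensional projective subspace is monochromatic (if $m\le t-1$, this value is $1$). -}

module Defs where

open import Level using (0ℓ)
open import Data.Nat using (ℕ; zero; suc; _≤_; _<_; _^_)
open import Data.Nat.Primality using (Prime)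
open import Data.Fin using (Fin)
open import Data.Vec using (Vec; []; _∷_; replicate; map; zipWith)
open import Data.Product using (Σ; ∃; _×_; ∃-syntax)
open import Relation.Nullary using (¬_)
open import Relation.Binary.PropositionalEquality using (_≡_; _≢_)
open import Function.Bundles using (_↔_)
import Algebra.Structures as AS

IsPrimePower : ℕ → Set
IsPrimePower q = ∃[ p ] ∃[ k ] (Prime p × 1 ≤ k × q ≡ p ^ k)

record FiniteField (q : ℕ) : Set₁ where
  infixl 7 _*_
  infixl 6 _+_
  field
    Carrier : Set
    _+_ _*_ : Carrier → Carrier → Carrier
    -_      : Carrier → Carrier
    0# 1#   : Carrier
    isCommutativeRing : AS.IsCommutativeRing {A = Carrier} _≡_ _+_ _*_ -_ 0# 1#
    0≢1     : 0# ≢ 1#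
    inverse : ∀ x → x ≢ 0# → ∃[ y ] (x * y ≡ 1#)
    enumeration : Fin q ↔ Carrier

module _ {q : ℕ} (F : FiniteField q) where
  open FiniteField F

  0v : ∀ {m} → Vec Carrier m
  0v {m} = replicate m 0#

  _·_ : ∀ {m} → Carrier → Vec Carrier m → Vec Carrier m
  λ' · v = map (λ' *_) v

  lincomb : ∀ {m t} → Vec (Vec Carrier m) t → Vec Carrier t → Vec Carrier m
  lincomb []      []       = 0v
  lincomb (b ∷ B) (c ∷ cs) = zipWith _+_ (c · b) (lincomb B cs)

  -- t vectors are linearly independent; they then span a t-dimensional
  -- linear subspace, i.e. a (t-1)-dimensional projective subspace
  LinIndep : ∀ {m t} → Vec (Vec Carrier m) t → Set
  LinIndep B = ∀ c → lincomb B c ≡ 0v → c ≡ 0v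

  -- a coloring of the points of PG(m-1,q) with k colors, given as a map on
  -- vectors of F^m that is constant on each 1-dimensional subspace
  -- (its value on the zero vector is irrelevant)
  PointColoring : ℕ → ℕ → Set
  PointColoring m k = Σ (Vec Carrier m → Fin k) λ col →
    ∀ (a : Carrier) (v : Vec Carrier m) → a ≢ 0# → v ≢ 0v → col (a · v) ≡ col v

  Monochromatic : ∀ {m t k} → (Vec Carrier m → Fin k) → Vec (Vec Carrier m) t → Set
  Monochromatic col B = ∀ c c' → c ≢ 0v → c' ≢ 0v → col (lincomb B c) ≡ col (lincomb B c')

  Colorable : (t m k : ℕ) → Set
  Colorable t m k = Σ (PointColoring m k) λ col →
    ∀ (B : Vec (Vec Carrier m) t) → LinIndep B → ¬ Monochromatic (Σ.proj₁ col) B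

  IsChi : (t m k : ℕ) → Set
  IsChi t m k = Colorable t m k × (∀ j → Colorable t m j → k ≤ j)

-- Split F^n = F^(n-d) ⊕ F^d.  Colour a point by an optimal colouring of F^(n-d)
-- applied to its first block when that block is nonzero, and otherwise by an
-- optimal colouring of F^d, with a disjoint palette, applied to its second block.
-- If a subspace is monochromatic in a colour of the first kind, then no nonzero
-- point of it has zero first block, so projecting onto the first block is
-- injective on it and gives a monochromatic subspace of the same dimension in
-- F^(n-d).  If the colour is of the second kind, the subspace lies in 0 ⊕ F^d.
module Submission where

open import Defs
open import Data.Nat using (ℕ; _≤_; _<_; _+_; _∸_; suc; s≤s)
open import Data.Nat.Properties using (m∸n+n≡m; <⇒≤)
open import Data.Fin using (Fin; join; splitAt)
open import Data.Fin.Properties using (splitAt-join; inj⇒≟)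
open import Data.Vec using (Vec; []; _∷_; replicate; map; zipWith; take; drop; head; tail)
open import Data.Vec.Properties
  using (≡-dec; map-cong; map-const; map-replicate; map-∘; map-id; take-zipWith; take-map; drop-zipWith; drop-map)
open import Data.Sum using (_⊎_; inj₁; inj₂)
open import Data.Product using (_×_; _,_; proj₁; proj₂)
open import Data.Empty using (⊥-elim)
open import Relation.Nullary using (¬_; yes; no)
open import Relation.Binary.Definitions using (DecidableEquality)
open import Relation.Binary.PropositionalEquality
open import Function.Properties.Inverse using (↔⇒↣; ↔-sym)
import Algebra.Structures as AS

module _ {q : ℕ} (F : FiniteField q) where
  open FiniteField F renaming (_+_ to _+ᶠ_; _*_ to _*ᶠ_)
  open AS.IsCommutativeRing isCommutativeRing using (zeroˡ; zeroʳ; *-assoc; *-comm; *-identityˡ)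
  open ≡-Reasoning

  infixr 7 _·ᵛ_

  0ᵛ : ∀ {m} → Vec Carrier m
  0ᵛ = 0v F

  _·ᵛ_ : ∀ {m} → Carrier → Vec Carrier m → Vec Carrier m
  _·ᵛ_ = _·_ F

  _≟_ : DecidableEquality Carrier
  _≟_ = inj⇒≟ (↔⇒↣ (↔-sym enumeration))

  _≟ᵛ_ : ∀ {m} → DecidableEquality (Vec Carrier m)
  _≟ᵛ_ = ≡-dec _≟_

  ·ᵛ-zeroˡ : ∀ {m} (v : Vec Carrier m) → 0# ·ᵛ v ≡ 0ᵛ
  ·ᵛ-zeroˡ v = trans (map-cong zeroˡ v) (map-const v 0#)

  ·ᵛ-zeroʳ : ∀ {m} a → a ·ᵛ 0ᵛ {m} ≡ 0ᵛ
  ·ᵛ-zeroʳ {m} a = trans (map-replicate (a *ᶠ_) 0# m) (cong (replicate m) (zeroʳ a))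

  ·ᵛ-assoc : ∀ {m} a b (v : Vec Carrier m) → a ·ᵛ b ·ᵛ v ≡ (a *ᶠ b) ·ᵛ v
  ·ᵛ-assoc a b v = trans (sym (map-∘ (a *ᶠ_) (b *ᶠ_) v)) (map-cong (λ x → sym (*-assoc a b x)) v)

  ·ᵛ-identityˡ : ∀ {m} (v : Vec Carrier m) → 1# ·ᵛ v ≡ v
  ·ᵛ-identityˡ v = trans (map-cong *-identityˡ v) (map-id v)

  a·v≡0⇒v≡0 : ∀ {m} {a} (v : Vec Carrier m) → a ≢ 0# → a ·ᵛ v ≡ 0ᵛ → v ≡ 0ᵛ
  a·v≡0⇒v≡0 {a = a} v a≢0 av≡0 with inverse a a≢0
  ... | a⁻¹ , aa⁻¹≡1 = begin
    v                 ≡⟨ sym (·ᵛ-identityˡ v) ⟩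
    1# ·ᵛ v           ≡⟨ cong (_·ᵛ v) (trans (sym aa⁻¹≡1) (*-comm a a⁻¹)) ⟩
    (a⁻¹ *ᶠ a) ·ᵛ v   ≡⟨ sym (·ᵛ-assoc a⁻¹ a v) ⟩
    a⁻¹ ·ᵛ a ·ᵛ v     ≡⟨ cong (a⁻¹ ·ᵛ_) av≡0 ⟩
    a⁻¹ ·ᵛ 0ᵛ         ≡⟨ ·ᵛ-zeroʳ a⁻¹ ⟩
    0ᵛ                ∎

  record IsLinear {m m′} (π : Vec Carrier m → Vec Carrier m′) : Set where
    field
      +-hom : ∀ u v → π (zipWith _+ᶠ_ u v) ≡ zipWith _+ᶠ_ (π u) (π v)
      ·-hom : ∀ a v → π (a ·ᵛ v) ≡ a ·ᵛ π v

    0-hom : π 0ᵛ ≡ 0ᵛ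
    0-hom = begin
      π 0ᵛ           ≡⟨ cong π (sym (·ᵛ-zeroˡ 0ᵛ)) ⟩
      π (0# ·ᵛ 0ᵛ)   ≡⟨ ·-hom 0# 0ᵛ ⟩
      0# ·ᵛ π 0ᵛ     ≡⟨ ·ᵛ-zeroˡ (π 0ᵛ) ⟩
      0ᵛ             ∎

    lincomb-hom : ∀ {t} (B : Vec (Vec Carrier m) t) c → π (lincomb F B c) ≡ lincomb F (map π B) c
    lincomb-hom []      []       = 0-hom
    lincomb-hom (b ∷ B) (c ∷ cs) = begin
      π (zipWith _+ᶠ_ (c ·ᵛ b) (lincomb F B cs))          ≡⟨ +-hom (c ·ᵛ b) (lincomb F B cs) ⟩
      zipWith _+ᶠ_ (π (c ·ᵛ b)) (π (lincomb F B cs))      ≡⟨ cong₂ (zipWith _+ᶠ_) (·-hom c b) (lincomb-hom B cs) ⟩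
      zipWith _+ᶠ_ (c ·ᵛ π b) (lincomb F (map π B) cs)    ∎

  take-isLinear : ∀ m₁ {m₂} → IsLinear (take m₁ {m₂})
  take-isLinear m₁ = record { +-hom = take-zipWith _+ᶠ_ ; ·-hom = λ a → take-map (a *ᶠ_) m₁ }

  drop-isLinear : ∀ m₁ {m₂} → IsLinear (drop m₁ {m₂})
  drop-isLinear m₁ = record { +-hom = drop-zipWith _+ᶠ_ ; ·-hom = λ a → drop-map (a *ᶠ_) m₁ }

  take≡0∧drop≡0⇒≡0 : ∀ m₁ {m₂} (v : Vec Carrier (m₁ + m₂)) → take m₁ v ≡ 0ᵛ → drop m₁ v ≡ 0ᵛ → v ≡ 0ᵛ
  take≡0∧drop≡0⇒≡0 0       v       _     drop≡0 = drop≡0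
  take≡0∧drop≡0⇒≡0 (suc m) (x ∷ v) take≡0 drop≡0 =
    cong₂ _∷_ (cong head take≡0) (take≡0∧drop≡0⇒≡0 m v (cong tail take≡0) drop≡0)

  ScaleInvariant : ∀ {m} {C : Set} → (Vec Carrier m → C) → Set
  ScaleInvariant col = ∀ a v → a ≢ 0# → v ≢ 0ᵛ → col (a ·ᵛ v) ≡ col v

  module _ {m m′ t} {π : Vec Carrier m → Vec Carrier m′} (linear : IsLinear π)
           (B : Vec (Vec Carrier m) t) where
    open IsLinear linear

    LinIndep-image : (∀ c → c ≢ 0ᵛ → π (lincomb F B c) ≢ 0ᵛ) → LinIndep F (map π B)
    LinIndep-image injective c image≡0 with c ≟ᵛ 0ᵛ
    ... | yes c≡0 = c≡0
    ... | no  c≢0 = ⊥-elim (injective c c≢0 (trans (lincomb-hom B c) image≡0))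

    Monochromatic-image : ∀ {k} (col : Vec Carrier m′ → Fin k) (x : Fin k) →
      (∀ c → c ≢ 0ᵛ → col (π (lincomb F B c)) ≡ x) → Monochromatic F col (map π B)
    Monochromatic-image col x constant c c′ c≢0 c′≢0 = begin
      col (lincomb F (map π B) c)    ≡⟨ cong col (sym (lincomb-hom B c)) ⟩
      col (π (lincomb F B c))        ≡⟨ constant c c≢0 ⟩
      x                              ≡⟨ sym (constant c′ c′≢0) ⟩
      col (π (lincomb F B c′))       ≡⟨ cong col (lincomb-hom B c′) ⟩
      col (lincomb F (map π B) c′)   ∎

  module _ {m₁ m₂ k₁ k₂} (col₁ : Vec Carrier m₁ → Fin k₁) (col₂ : Vec Carrier m₂ → Fin k₂) where

    blockColor : Vec Carrier (m₁ + m₂) → Fin k₁ ⊎ Fin k₂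
    blockColor v with take m₁ v ≟ᵛ 0ᵛ
    ... | yes _ = inj₂ (col₂ (drop m₁ v))
    ... | no  _ = inj₁ (col₁ (take m₁ v))

    blockColor≡inj₁ : ∀ v {x} → blockColor v ≡ inj₁ x → take m₁ v ≢ 0ᵛ × col₁ (take m₁ v) ≡ x
    blockColor≡inj₁ v eq with take m₁ v ≟ᵛ 0ᵛ
    blockColor≡inj₁ v refl | no take≢0 = take≢0 , refl

    blockColor≡inj₂ : ∀ v {y} → blockColor v ≡ inj₂ y → take m₁ v ≡ 0ᵛ × col₂ (drop m₁ v) ≡ y
    blockColor≡inj₂ v eq with take m₁ v ≟ᵛ 0ᵛ
    blockColor≡inj₂ v refl | yes take≡0 = take≡0 , refl

    blockColor-invariant : ScaleInvariant col₁ → ScaleInvariant col₂ → ScaleInvariant blockColor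
    blockColor-invariant inv₁ inv₂ a v a≢0 v≢0
      with take m₁ v ≟ᵛ 0ᵛ | take m₁ (a ·ᵛ v) ≟ᵛ 0ᵛ
    ... | yes take≡0 | yes _ = cong inj₂ (trans (cong col₂ (drop-map (a *ᶠ_) m₁ v))
            (inv₂ a (drop m₁ v) a≢0 (λ drop≡0 → v≢0 (take≡0∧drop≡0⇒≡0 m₁ v take≡0 drop≡0))))
    ... | yes take≡0 | no  take-av≢0 =
            ⊥-elim (take-av≢0 (trans (take-map (a *ᶠ_) m₁ v) (trans (cong (a ·ᵛ_) take≡0) (·ᵛ-zeroʳ a))))
    ... | no  take≢0 | yes take-av≡0 =
            ⊥-elim (take≢0 (a·v≡0⇒v≡0 (take m₁ v) a≢0 (trans (sym (take-map (a *ᶠ_) m₁ v)) take-av≡0)))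
    ... | no  take≢0 | no  _ = cong inj₁ (trans (cong col₁ (take-map (a *ᶠ_) m₁ v))
            (inv₁ a (take m₁ v) a≢0 take≢0))

  colorable-+ : ∀ {t m₁ m₂ k₁ k₂} → Colorable F (suc t) m₁ k₁ → Colorable F (suc t) m₂ k₂ →
    Colorable F (suc t) (m₁ + m₂) (k₁ + k₂)
  colorable-+ {t} {m₁} {m₂} {k₁} {k₂} ((col₁ , inv₁) , noMono₁) ((col₂ , inv₂) , noMono₂) =
    (color , λ a v a≢0 v≢0 → cong (join k₁ k₂) (blockColor-invariant col₁ col₂ inv₁ inv₂ a v a≢0 v≢0)) , noMono
    where
    color : Vec Carrier (m₁ + m₂) → Fin (k₁ + k₂)
    color v = join k₁ k₂ (blockColor col₁ col₂ v)

    join-injective : ∀ {i j} → join k₁ k₂ i ≡ join k₁ k₂ j → i ≡ j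
    join-injective {i} {j} eq = trans (sym (splitAt-join k₁ k₂ i)) (trans (cong (splitAt k₁) eq) (splitAt-join k₁ k₂ j))

    e₀ : Vec Carrier (suc t)
    e₀ = 1# ∷ 0ᵛ

    e₀≢0 : e₀ ≢ 0ᵛ
    e₀≢0 e₀≡0 = 0≢1 (sym (cong head e₀≡0))

    noMono : ∀ B → LinIndep F B → ¬ Monochromatic F color B
    noMono B indep mono with blockColor col₁ col₂ (lincomb F B e₀) in e₀-color
    ... | inj₁ x = noMono₁ (map (take m₁) B)
          (LinIndep-image (take-isLinear m₁) B (λ c c≢0 → proj₁ (colored-by-first-block c c≢0)))
          (Monochromatic-image (take-isLinear m₁) B col₁ x (λ c c≢0 → proj₂ (colored-by-first-block c c≢0)))
      where
      colored-by-first-block : ∀ c → c ≢ 0ᵛ → take m₁ (lincomb F B c) ≢ 0ᵛ × col₁ (take m₁ (lincomb F B c)) ≡ x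
      colored-by-first-block c c≢0 = blockColor≡inj₁ col₁ col₂ (lincomb F B c)
        (trans (join-injective (mono c e₀ c≢0 e₀≢0)) e₀-color)
    ... | inj₂ y = noMono₂ (map (drop m₁) B)
          (LinIndep-image (drop-isLinear m₁) B
            (λ c c≢0 drop≡0 → c≢0 (indep c (take≡0∧drop≡0⇒≡0 m₁ _ (proj₁ (colored-by-second-block c c≢0)) drop≡0))))
          (Monochromatic-image (drop-isLinear m₁) B col₂ y (λ c c≢0 → proj₂ (colored-by-second-block c c≢0)))
      where
      colored-by-second-block : ∀ c → c ≢ 0ᵛ → take m₁ (lincomb F B c) ≡ 0ᵛ × col₂ (drop m₁ (lincomb F B c)) ≡ y
      colored-by-second-block c c≢0 = blockColor≡inj₂ col₁ col₂ (lincomb F B c)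
        (trans (join-injective (mono c e₀ c≢0 e₀≢0)) e₀-color)

lemma2p1 : ∀ {q : ℕ} → IsPrimePower q → (F : FiniteField q) →
    (t n d : ℕ) → 2 ≤ t → 1 ≤ d → d < n →
    (a b c : ℕ) → IsChi F t (n ∸ d) a → IsChi F t d b → IsChi F t n c →
    c ≤ a + b
lemma2p1 _ F t n d (s≤s _) _ d<n a b c (colorable-a , _) (colorable-b , _) (_ , minimal-c) =
  minimal-c (a + b)
    (subst (λ m → Colorable F t m (a + b)) (m∸n+n≡m (<⇒≤ d<n)) (colorable-+ F colorable-a colorable-b))
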